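{- Let $\mathsf{C}$ be a category with binary coproducts, let $(T,\mu,\eta)$ be a monad on $\mathsf{C}$ and let $F:\mathsf{C}\to\mathsf{C}$ be a functor that lifts to a functor $\overline{F}:\mathcal{K}l(T)\to\mathcal{K}l(T)$. Assume that $\mathcal{K}l(T)$ is a category with zero morphisms $0_{X,Y}:X\rightsquigarrow Y$. Define on the endofunctor $\overline{F}+\mathcal{I}d$ of $\mathcal{K}l(T)$ the natural transformations $e:\mathcal{I}d\Rightarrow \overline{F}+\mathcal{I}d$, $e=\mathsf{inr}$, and $$m:\overline{F}(\overline{F}+\mathcal{I}d)+(\overline{F}+\mathcal{I}d)\xrightarrow{\ \overline{F}([0,id])+id\ } \overline{F}+(\overline{F}+\mathcal{I}d)\xrightarrow{\ [\mathsf{inl},id]\ }\overline{F}+\mathcal{I}d,$$ where $[0,id]:\overline{F}X+X\rightsquigarrow X$ is the cotuple of the zero morphism $0_{FX,X}$ and the identity. Then $(\overline{F}+\mathcal{I}d,m,e)$ is a monad on $\mathcal{K}l(T)$.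
   Context: For a monad $(T,\mu,\eta)$ on $\mathsf{C}$, the Kleisli category $\mathcal{K}l(T)$ has the objects of $\mathsf{C}$; a morphism $f:X\rightsquigarrow Y$ is a morphism $f:X\to TY$ of $\mathsf{C}$; composition is $g\cdot f=\mu_Z\circ Tg\circ f$ and identities are $1_X=\eta_X$. For $f:X\to Y$ in $\mathsf{C}$ put $f^\sharp=\eta_Y\circ f:X\rightsquigarrow Y$. A functor $F$ on $\mathsf{C}$ lifts to $\overline{F}$ on $\mathcal{K}l(T)$ if $\overline{F}X=FX$ and $\overline{F}(f^\sharp)=(Ff)^\sharp$ for all $f$ of $\mathsf{C}$ (equivalently, $\overline{F}g=\lambda_Y\circ Fg$ for a distributive law $\lambda:FT\Rightarrow TF$). Coproducts in $\mathcal{K}l(T)$ are those of $\mathsf{C}$: $X+Y$ with coprojections $\mathsf{inl}^\sharp,\mathsf{inr}^\sharp$ (written $\mathsf{inl},\mathsf{inr}$), and cotupling in $\mathcal{K}l(T)$ is cotupling in $\mathsf{C}$. A category has zero morphisms if for all objects $X,Y$ there is $0_{X,Y}:X\to Y$ with $f\circ 0_{X,Y}=0_{X,Z}=0_{Y,Z}\circ g$ for all $f:Y\to Z$, $g:X\to Y$. -}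

module Defs where

open import Level using (Level; _⊔_; suc)
open import Relation.Binary using (IsEquivalence)

record RawCategory (o ℓ e : Level) : Set (suc (o ⊔ ℓ ⊔ e)) where
  infixr 9 _∘_
  infix 4 _≈_
  infix 5 _⇒_
  field
    Obj : Set o
    _⇒_ : Obj → Obj → Set ℓ
    _≈_ : ∀ {A B} → (A ⇒ B) → (A ⇒ B) → Set e
    id  : ∀ {A} → A ⇒ A
    _∘_ : ∀ {A B C} → (B ⇒ C) → (A ⇒ B) → (A ⇒ C)

record Category (o ℓ e : Level) : Set (suc (o ⊔ ℓ ⊔ e)) where
  field
    raw : RawCategory o ℓ e
  open RawCategory raw public
  field
    equiv     : ∀ {A B} → IsEquivalence (_≈_ {A} {B})
    assoc     : ∀ {A B C D} {f : A ⇒ B} {g : B ⇒ C} {h : C ⇒ D} →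
                (h ∘ g) ∘ f ≈ h ∘ (g ∘ f)
    identityˡ : ∀ {A B} {f : A ⇒ B} → id ∘ f ≈ f
    identityʳ : ∀ {A B} {f : A ⇒ B} → f ∘ id ≈ f
    ∘-resp-≈  : ∀ {A B C} {f h : B ⇒ C} {g i : A ⇒ B} →
                f ≈ h → g ≈ i → f ∘ g ≈ h ∘ i

record IsFunctor {o ℓ e o′ ℓ′ e′} (C : RawCategory o ℓ e) (D : RawCategory o′ ℓ′ e′)
                 (F₀ : RawCategory.Obj C → RawCategory.Obj D)
                 (F₁ : ∀ {A B} → RawCategory._⇒_ C A B → RawCategory._⇒_ D (F₀ A) (F₀ B))
                 : Set (o ⊔ ℓ ⊔ e ⊔ ℓ′ ⊔ e′) where
  private
    module C = RawCategory C
    module D = RawCategory D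
  field
    identity     : ∀ {A} → F₁ (C.id {A}) D.≈ D.id
    homomorphism : ∀ {X Y Z} {f : X C.⇒ Y} {g : Y C.⇒ Z} →
                   F₁ (g C.∘ f) D.≈ F₁ g D.∘ F₁ f
    F-resp-≈     : ∀ {A B} {f g : A C.⇒ B} → f C.≈ g → F₁ f D.≈ F₁ g

record IsMonad {o ℓ e} (D : RawCategory o ℓ e)
               (G₀ : RawCategory.Obj D → RawCategory.Obj D)
               (G₁ : ∀ {A B} → RawCategory._⇒_ D A B → RawCategory._⇒_ D (G₀ A) (G₀ B))
               (μ : ∀ X → RawCategory._⇒_ D (G₀ (G₀ X)) (G₀ X))
               (η : ∀ X → RawCategory._⇒_ D X (G₀ X))
               : Set (o ⊔ ℓ ⊔ e) where
  open RawCategory D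
  field
    isFunctor   : IsFunctor D D G₀ G₁
    η-natural   : ∀ {X Y} (f : X ⇒ Y) → G₁ f ∘ η X ≈ η Y ∘ f
    μ-natural   : ∀ {X Y} (f : X ⇒ Y) → G₁ f ∘ μ X ≈ μ Y ∘ G₁ (G₁ f)
    assoc       : ∀ {X} → μ X ∘ G₁ (μ X) ≈ μ X ∘ μ (G₀ X)
    identityˡ   : ∀ {X} → μ X ∘ G₁ (η X) ≈ id
    identityʳ   : ∀ {X} → μ X ∘ η (G₀ X) ≈ id

record Endofunctor {o ℓ e} (C : Category o ℓ e) : Set (o ⊔ ℓ ⊔ e) where
  open Category C
  field
    F₀ : Obj → Obj
    F₁ : ∀ {A B} → A ⇒ B → F₀ A ⇒ F₀ B
    isFunctor : IsFunctor raw raw F₀ F₁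
  open IsFunctor isFunctor public

record Monad {o ℓ e} (C : Category o ℓ e) : Set (o ⊔ ℓ ⊔ e) where
  open Category C
  field
    T  : Endofunctor C
  open Endofunctor T public using (F₀; F₁)
  field
    η : ∀ X → X ⇒ F₀ X
    μ : ∀ X → F₀ (F₀ X) ⇒ F₀ X
    isMonad : IsMonad raw F₀ F₁ μ η

record BinaryCoproducts {o ℓ e} (C : Category o ℓ e) : Set (o ⊔ ℓ ⊔ e) where
  open Category C
  infixr 7 _+_
  field
    _+_   : Obj → Obj → Obj
    inl   : ∀ {A B} → A ⇒ A + B
    inr   : ∀ {A B} → B ⇒ A + B
    [_,_] : ∀ {A B X} → A ⇒ X → B ⇒ X → A + B ⇒ X
    inject₁ : ∀ {A B X} {f : A ⇒ X} {g : B ⇒ X} → [ f , g ] ∘ inl ≈ f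
    inject₂ : ∀ {A B X} {f : A ⇒ X} {g : B ⇒ X} → [ f , g ] ∘ inr ≈ g
    unique  : ∀ {A B X} {f : A ⇒ X} {g : B ⇒ X} {h : A + B ⇒ X} →
              h ∘ inl ≈ f → h ∘ inr ≈ g → [ f , g ] ≈ h

module _ {o ℓ e} {C : Category o ℓ e} (M : Monad C) where
  open Category C
  open Monad M

  Kl : RawCategory o ℓ e
  Kl = record
    { Obj = Obj
    ; _⇒_ = λ X Y → X ⇒ F₀ Y
    ; _≈_ = _≈_
    ; id  = λ {X} → η X
    ; _∘_ = λ {X Y Z} g f → μ Z ∘ (F₁ g ∘ f)
    }

  _♯ : ∀ {X Y} → X ⇒ Y → RawCategory._⇒_ Kl X Y
  _♯ {X} {Y} f = η Y ∘ f

  record Lifting (F : Endofunctor C) : Set (o ⊔ ℓ ⊔ e) where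
    private module F = Endofunctor F
    field
      F̄₁ : ∀ {A B} → RawCategory._⇒_ Kl A B → RawCategory._⇒_ Kl (F.F₀ A) (F.F₀ B)
      isFunctor : IsFunctor Kl Kl F.F₀ F̄₁
      lifts : ∀ {X Y} (f : X ⇒ Y) → F̄₁ (f ♯) ≈ (F.F₁ f) ♯

record ZeroMorphisms {o ℓ e} (D : RawCategory o ℓ e) : Set (o ⊔ ℓ ⊔ e) where
  open RawCategory D
  field
    zero : ∀ X Y → X ⇒ Y
    zero-left  : ∀ {X Y Z} (f : Y ⇒ Z) → f ∘ zero X Y ≈ zero X Z
    zero-right : ∀ {X Y Z} (g : X ⇒ Y) → zero Y Z ∘ g ≈ zero X Z

module FreeConstruction {o ℓ e} {C : Category o ℓ e}
         (cp : BinaryCoproducts C) (M : Monad C)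
         (F : Endofunctor C) (L : Lifting M F) (Z : ZeroMorphisms (Kl M)) where
  open BinaryCoproducts cp using (_+_; [_,_]) renaming (inl to inlC; inr to inrC)
  private
    module F = Endofunctor F
    module L = Lifting L
    module Z = ZeroMorphisms Z
  open RawCategory (Kl M) renaming (_⇒_ to _⇝_; _∘_ to _·_; id to 1K)

  inl : ∀ {A B} → A ⇝ (A + B)
  inl = _♯ M inlC
  inr : ∀ {A B} → B ⇝ (A + B)
  inr = _♯ M inrC

  _⊕_ : ∀ {A B A′ B′} → A ⇝ A′ → B ⇝ B′ → (A + B) ⇝ (A′ + B′)
  f ⊕ g = [ inl · f , inr · g ]

  G₀ : RawCategory.Obj (Kl M) → RawCategory.Obj (Kl M)
  G₀ X = F.F₀ X + X

  G₁ : ∀ {A B} → A ⇝ B → G₀ A ⇝ G₀ B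
  G₁ f = L.F̄₁ f ⊕ f

  unit : ∀ X → X ⇝ G₀ X
  unit X = inr

  collapse : ∀ X → G₀ X ⇝ X
  collapse X = [ Z.zero (F.F₀ X) X , 1K ]

  mult : ∀ X → G₀ (G₀ X) ⇝ G₀ X
  mult X = [ inl , 1K ] · (L.F̄₁ (collapse X) ⊕ 1K)

-- The unit is the right injection, and the multiplication keeps the outer F̄-layer
-- while collapsing the inner one with [0, id]: a term of shape F̄(F̄X) is sent to 0.
-- The laws reduce to naturality of collapse = [0, id] and to the fact that collapsing
-- after multiplying equals collapsing twice, both sides killing the doubly nested layer.
-- Beyond the facts that Kl(T) is a category and inherits the coproducts of C, nothing
-- Kleisli-specific is used: the construction is a monad for every endofunctor H of
-- any category with binary coproducts and zero morphisms.
module Submission where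

open import Relation.Binary using (IsEquivalence)
open import Relation.Binary.Bundles using (Setoid)
import Relation.Binary.Reasoning.Setoid as SetoidReasoning
open import Defs

module CategoryReasoning {o ℓ e} (D : Category o ℓ e) where
  open Category D

  hom-setoid : Obj → Obj → Setoid ℓ e
  hom-setoid A B = record { Carrier = A ⇒ B ; _≈_ = _≈_ ; isEquivalence = equiv }

  module Equiv {A B : Obj} = IsEquivalence (equiv {A} {B})
  open Equiv public using (refl; sym; trans)
  module HomReasoning {A B : Obj} = SetoidReasoning (hom-setoid A B)
  open HomReasoning public using (begin_; step-≈-⟩; step-≈-⟨; _∎)

  sym-assoc : ∀ {A B C E} {f : A ⇒ B} {g : B ⇒ C} {h : C ⇒ E} →
              h ∘ (g ∘ f) ≈ (h ∘ g) ∘ f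
  sym-assoc = sym assoc

  ∘-resp-≈ˡ : ∀ {A B C} {f h : B ⇒ C} {g : A ⇒ B} → f ≈ h → f ∘ g ≈ h ∘ g
  ∘-resp-≈ˡ p = ∘-resp-≈ p refl

  ∘-resp-≈ʳ : ∀ {A B C} {f : B ⇒ C} {g i : A ⇒ B} → g ≈ i → f ∘ g ≈ f ∘ i
  ∘-resp-≈ʳ p = ∘-resp-≈ refl p

module CoproductProperties {o ℓ e} {D : Category o ℓ e} (cp : BinaryCoproducts D) where
  open Category D
  open BinaryCoproducts cp
  open CategoryReasoning D

  infixr 7 _⊕_
  _⊕_ : ∀ {A B A′ B′} → A ⇒ A′ → B ⇒ B′ → A + B ⇒ A′ + B′
  f ⊕ g = [ inl ∘ f , inr ∘ g ]

  []-cong₂ : ∀ {A B X} {f f′ : A ⇒ X} {g g′ : B ⇒ X} →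
             f ≈ f′ → g ≈ g′ → [ f , g ] ≈ [ f′ , g′ ]
  []-cong₂ p q = unique (trans inject₁ (sym p)) (trans inject₂ (sym q))

  [inl,inr]≈id : ∀ {A B} → [ inl , inr ] ≈ id {A + B}
  [inl,inr]≈id = unique identityˡ identityˡ

  ∘-distribˡ-[] : ∀ {A B X Y} {f : A ⇒ X} {g : B ⇒ X} {h : X ⇒ Y} →
                  h ∘ [ f , g ] ≈ [ h ∘ f , h ∘ g ]
  ∘-distribˡ-[] = sym (unique (trans assoc (∘-resp-≈ʳ inject₁))
                              (trans assoc (∘-resp-≈ʳ inject₂)))

  inject₁ʳ : ∀ {A B X Y} {f : A ⇒ X} {g : B ⇒ X} {h : Y ⇒ A} → [ f , g ] ∘ (inl ∘ h) ≈ f ∘ h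
  inject₁ʳ = trans sym-assoc (∘-resp-≈ˡ inject₁)

  inject₂ʳ : ∀ {A B X Y} {f : A ⇒ X} {g : B ⇒ X} {h : Y ⇒ B} → [ f , g ] ∘ (inr ∘ h) ≈ g ∘ h
  inject₂ʳ = trans sym-assoc (∘-resp-≈ˡ inject₂)

module KleisliCategory {o ℓ e} {C : Category o ℓ e} (M : Monad C) where
  open Category C
  open CategoryReasoning C
  open Monad M using (η; μ) renaming (F₀ to T₀; F₁ to T₁)
  private
    module T = IsMonad (Monad.isMonad M)
    module TF = IsFunctor T.isFunctor
  open RawCategory (Kl M) using () renaming (_∘_ to _·_)

  ·-resp-≈ : ∀ {X Y W} {f h : Y ⇒ T₀ W} {g i : X ⇒ T₀ Y} → f ≈ h → g ≈ i → f · g ≈ h · i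
  ·-resp-≈ p q = ∘-resp-≈ʳ (∘-resp-≈ (TF.F-resp-≈ p) q)

  ·-identityˡ : ∀ {X Y} {f : X ⇒ T₀ Y} → η Y · f ≈ f
  ·-identityˡ = trans sym-assoc (trans (∘-resp-≈ˡ T.identityˡ) identityˡ)

  ·-♯ : ∀ {X Y W} (g : Y ⇒ T₀ W) (f : X ⇒ Y) → g · (_♯ M f) ≈ g ∘ f
  ·-♯ {Y = Y} {W} g f = begin
    μ W ∘ (T₁ g ∘ (η Y ∘ f))   ≈⟨ ∘-resp-≈ʳ sym-assoc ⟩
    μ W ∘ ((T₁ g ∘ η Y) ∘ f)   ≈⟨ ∘-resp-≈ʳ (∘-resp-≈ˡ (T.η-natural g)) ⟩
    μ W ∘ ((η (T₀ W) ∘ g) ∘ f) ≈⟨ trans (∘-resp-≈ʳ assoc) sym-assoc ⟩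
    (μ W ∘ η (T₀ W)) ∘ (g ∘ f) ≈⟨ trans (∘-resp-≈ˡ T.identityʳ) identityˡ ⟩
    g ∘ f                      ∎

  ·-identityʳ : ∀ {X Y} {f : X ⇒ T₀ Y} → f · η X ≈ f
  ·-identityʳ {f = f} =
    trans (·-resp-≈ refl (sym identityʳ)) (trans (·-♯ f id) identityʳ)

  ·-assoc : ∀ {X Y W V} {f : X ⇒ T₀ Y} {g : Y ⇒ T₀ W} {h : W ⇒ T₀ V} →
            (h · g) · f ≈ h · (g · f)
  ·-assoc {W = W} {V} {f} {g} {h} = begin
    μ V ∘ (T₁ (μ V ∘ (T₁ h ∘ g)) ∘ f)
      ≈⟨ ∘-resp-≈ʳ (∘-resp-≈ˡ (trans TF.homomorphism (∘-resp-≈ʳ TF.homomorphism))) ⟩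
    μ V ∘ ((T₁ (μ V) ∘ (T₁ (T₁ h) ∘ T₁ g)) ∘ f)
      ≈⟨ trans (∘-resp-≈ʳ assoc) sym-assoc ⟩
    (μ V ∘ T₁ (μ V)) ∘ ((T₁ (T₁ h) ∘ T₁ g) ∘ f)
      ≈⟨ trans (∘-resp-≈ˡ T.assoc) assoc ⟩
    μ V ∘ (μ (T₀ V) ∘ ((T₁ (T₁ h) ∘ T₁ g) ∘ f))
      ≈⟨ ∘-resp-≈ʳ (trans (∘-resp-≈ʳ assoc) sym-assoc) ⟩
    μ V ∘ ((μ (T₀ V) ∘ T₁ (T₁ h)) ∘ (T₁ g ∘ f))
      ≈⟨ ∘-resp-≈ʳ (trans (∘-resp-≈ˡ (sym (T.μ-natural h))) assoc) ⟩
    μ V ∘ (T₁ h ∘ (μ W ∘ (T₁ g ∘ f)))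
      ∎

  Kleisli : Category o ℓ e
  Kleisli = record
    { raw       = Kl M
    ; equiv     = equiv
    ; assoc     = ·-assoc
    ; identityˡ = ·-identityˡ
    ; identityʳ = ·-identityʳ
    ; ∘-resp-≈  = ·-resp-≈
    }

  Kleisli-coproducts : BinaryCoproducts C → BinaryCoproducts Kleisli
  Kleisli-coproducts cp = record
    { _+_     = _+_
    ; inl     = _♯ M inl
    ; inr     = _♯ M inr
    ; [_,_]   = [_,_]
    ; inject₁ = trans (·-♯ _ inl) inject₁
    ; inject₂ = trans (·-♯ _ inr) inject₂
    ; unique  = λ p q → unique (trans (sym (·-♯ _ inl)) p) (trans (sym (·-♯ _ inr)) q)
    }
    where open BinaryCoproducts cp

  lifted-functor : (F : Endofunctor C) → Lifting M F → Endofunctor Kleisli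
  lifted-functor F L = record
    { F₀ = Endofunctor.F₀ F ; F₁ = Lifting.F̄₁ L ; isFunctor = Lifting.isFunctor L }

module SumWithIdentityMonad {o ℓ e} (D : Category o ℓ e) (cp : BinaryCoproducts D)
         (H : Endofunctor D) (Z : ZeroMorphisms (Category.raw D)) where
  open Category D
  open CategoryReasoning D
  open BinaryCoproducts cp
  open CoproductProperties cp
  open Endofunctor H renaming (F₀ to H₀; F₁ to H₁)
  open ZeroMorphisms Z

  G₀ : Obj → Obj
  G₀ X = H₀ X + X

  G₁ : ∀ {A B} → A ⇒ B → G₀ A ⇒ G₀ B
  G₁ f = H₁ f ⊕ f

  unit : ∀ X → X ⇒ G₀ X
  unit X = inr

  collapse : ∀ X → G₀ X ⇒ X
  collapse X = [ zero (H₀ X) X , id ]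

  mult : ∀ X → G₀ (G₀ X) ⇒ G₀ X
  mult X = [ inl , id ] ∘ (H₁ (collapse X) ⊕ id)

  -- Definitionally G₁ f is
  -- ⟪ f , inr ∘ f ⟫, and mult X ≈ ⟪ collapse X , id ⟫; these cotuples compose
  -- by composing their first components, which is all the monad laws need.
  ⟪_,_⟫ : ∀ {A B X} → A ⇒ X → B ⇒ G₀ X → H₀ A + B ⇒ G₀ X
  ⟪ a , b ⟫ = [ inl ∘ H₁ a , b ]

  ⟪⟫-cong : ∀ {A B X} {a a′ : A ⇒ X} {b b′ : B ⇒ G₀ X} → a ≈ a′ → b ≈ b′ → ⟪ a , b ⟫ ≈ ⟪ a′ , b′ ⟫
  ⟪⟫-cong p q = []-cong₂ (∘-resp-≈ʳ (F-resp-≈ p)) q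

  ⟪⟫∘⟪⟫ : ∀ {A B X Y} {a : A ⇒ X} {b : B ⇒ G₀ X} {c : X ⇒ Y} {d : X ⇒ G₀ Y} →
          ⟪ c , d ⟫ ∘ ⟪ a , b ⟫ ≈ ⟪ c ∘ a , ⟪ c , d ⟫ ∘ b ⟫
  ⟪⟫∘⟪⟫ = trans ∘-distribˡ-[]
    ([]-cong₂ (trans inject₁ʳ (trans assoc (∘-resp-≈ʳ (sym homomorphism)))) refl)

  ⟪id,inr⟫≈id : ∀ {X} → ⟪ id , inr ⟫ ≈ id {G₀ X}
  ⟪id,inr⟫≈id = trans ([]-cong₂ (trans (∘-resp-≈ʳ identity) identityʳ) refl) [inl,inr]≈id

  mult≈⟪collapse,id⟫ : ∀ {X} → mult X ≈ ⟪ collapse X , id ⟫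
  mult≈⟪collapse,id⟫ = trans ∘-distribˡ-[] ([]-cong₂ inject₁ʳ (trans inject₂ʳ identityˡ))

  ∘-collapse : ∀ {X Y} (f : X ⇒ Y) → f ∘ collapse X ≈ [ zero (H₀ X) Y , f ]
  ∘-collapse f = trans ∘-distribˡ-[] ([]-cong₂ (zero-left f) identityʳ)

  collapse-natural : ∀ {X Y} (f : X ⇒ Y) → collapse Y ∘ G₁ f ≈ f ∘ collapse X
  collapse-natural f = begin
    collapse _ ∘ G₁ f                           ≈⟨ ∘-distribˡ-[] ⟩
    [ collapse _ ∘ (inl ∘ H₁ f) , collapse _ ∘ (inr ∘ f) ]
      ≈⟨ []-cong₂ (trans inject₁ʳ (zero-right (H₁ f))) (trans inject₂ʳ identityˡ) ⟩
    [ zero _ _ , f ]                            ≈⟨ ∘-collapse f ⟨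
    f ∘ collapse _                              ∎

  collapse-mult : ∀ {X} → collapse X ∘ mult X ≈ collapse X ∘ collapse (G₀ X)
  collapse-mult {X} = begin
    collapse X ∘ mult X                        ≈⟨ ∘-resp-≈ʳ mult≈⟪collapse,id⟫ ⟩
    collapse X ∘ ⟪ collapse X , id ⟫           ≈⟨ ∘-distribˡ-[] ⟩
    [ collapse X ∘ (inl ∘ H₁ (collapse X)) , collapse X ∘ id ]
      ≈⟨ []-cong₂ (trans inject₁ʳ (zero-right _)) identityʳ ⟩
    [ zero _ _ , collapse X ]                  ≈⟨ ∘-collapse (collapse X) ⟨
    collapse X ∘ collapse (G₀ X)               ∎

  G-isFunctor : IsFunctor raw raw G₀ G₁
  G-isFunctor = record
    { identity     = trans (⟪⟫-cong refl identityʳ) ⟪id,inr⟫≈id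
    ; homomorphism = sym (trans ⟪⟫∘⟪⟫ (⟪⟫-cong refl (trans inject₂ʳ assoc)))
    ; F-resp-≈     = λ p → ⟪⟫-cong p (∘-resp-≈ʳ p)
    }

  mult-natural : ∀ {X Y} (f : X ⇒ Y) → G₁ f ∘ mult X ≈ mult Y ∘ G₁ (G₁ f)
  mult-natural {X} {Y} f = begin
    G₁ f ∘ mult X                            ≈⟨ ∘-resp-≈ʳ mult≈⟪collapse,id⟫ ⟩
    G₁ f ∘ ⟪ collapse X , id ⟫               ≈⟨ ⟪⟫∘⟪⟫ ⟩
    ⟪ f ∘ collapse X , G₁ f ∘ id ⟫
      ≈⟨ ⟪⟫-cong (collapse-natural f) (trans identityˡ (sym identityʳ)) ⟨
    ⟪ collapse Y ∘ G₁ f , id ∘ G₁ f ⟫        ≈⟨ ⟪⟫-cong refl inject₂ʳ ⟨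
    ⟪ collapse Y ∘ G₁ f , ⟪ collapse Y , id ⟫ ∘ (inr ∘ G₁ f) ⟫ ≈⟨ ⟪⟫∘⟪⟫ ⟨
    ⟪ collapse Y , id ⟫ ∘ G₁ (G₁ f)          ≈⟨ ∘-resp-≈ˡ mult≈⟪collapse,id⟫ ⟨
    mult Y ∘ G₁ (G₁ f)                       ∎

  mult-assoc : ∀ {X} → mult X ∘ G₁ (mult X) ≈ mult X ∘ mult (G₀ X)
  mult-assoc {X} = begin
    mult X ∘ G₁ (mult X)                     ≈⟨ ∘-resp-≈ˡ mult≈⟪collapse,id⟫ ⟩
    ⟪ collapse X , id ⟫ ∘ G₁ (mult X)        ≈⟨ ⟪⟫∘⟪⟫ ⟩
    ⟪ collapse X ∘ mult X , ⟪ collapse X , id ⟫ ∘ (inr ∘ mult X) ⟫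
      ≈⟨ ⟪⟫-cong collapse-mult (trans inject₂ʳ identityˡ) ⟩
    ⟪ collapse X ∘ collapse (G₀ X) , mult X ⟫
      ≈⟨ ⟪⟫-cong refl (trans identityʳ (sym mult≈⟪collapse,id⟫)) ⟨
    ⟪ collapse X ∘ collapse (G₀ X) , ⟪ collapse X , id ⟫ ∘ id ⟫ ≈⟨ ⟪⟫∘⟪⟫ ⟨
    ⟪ collapse X , id ⟫ ∘ ⟪ collapse (G₀ X) , id ⟫
      ≈⟨ ∘-resp-≈ mult≈⟪collapse,id⟫ mult≈⟪collapse,id⟫ ⟨
    mult X ∘ mult (G₀ X)                     ∎

  mult-identityˡ : ∀ {X} → mult X ∘ G₁ (unit X) ≈ id
  mult-identityˡ {X} = begin
    mult X ∘ G₁ inr                          ≈⟨ ∘-resp-≈ˡ mult≈⟪collapse,id⟫ ⟩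
    ⟪ collapse X , id ⟫ ∘ G₁ inr             ≈⟨ ⟪⟫∘⟪⟫ ⟩
    ⟪ collapse X ∘ inr , ⟪ collapse X , id ⟫ ∘ (inr ∘ inr) ⟫
      ≈⟨ ⟪⟫-cong inject₂ (trans inject₂ʳ identityˡ) ⟩
    ⟪ id , inr ⟫                             ≈⟨ ⟪id,inr⟫≈id ⟩
    id                                       ∎

  mult-identityʳ : ∀ {X} → mult X ∘ unit (G₀ X) ≈ id
  mult-identityʳ = trans (∘-resp-≈ˡ mult≈⟪collapse,id⟫) inject₂

  isMonad : IsMonad raw G₀ G₁ mult unit
  isMonad = record
    { isFunctor = G-isFunctor
    ; η-natural = λ f → inject₂
    ; μ-natural = mult-natural
    ; assoc     = mult-assoc
    ; identityˡ = mult-identityˡ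
    ; identityʳ = mult-identityʳ
    }

theorem4p3 : ∀ {o ℓ e} {C : Category o ℓ e} (cp : BinaryCoproducts C) (M : Monad C)
    (F : Endofunctor C) (L : Lifting M F) (Z : ZeroMorphisms (Kl M)) →
    IsMonad (Kl M) (FreeConstruction.G₀ cp M F L Z) (FreeConstruction.G₁ cp M F L Z)
    (FreeConstruction.mult cp M F L Z) (FreeConstruction.unit cp M F L Z)
theorem4p3 cp M F L Z =
  SumWithIdentityMonad.isMonad Kleisli (Kleisli-coproducts cp) (lifted-functor F L) Z
  where open KleisliCategory M
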